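{- Let $m$ and $n$ be positive integers with $n>1$. Then \[ \text{(a)}\quad \sum_{d\mid n}\mu(d)\left(\left\lfloor\frac{m+1}{d}\right\rfloor-\left\lfloor\frac{m-1}{d}\right\rfloor\right)=\begin{cases}0,& \gcd(m,n)>1\text{ and }\gcd(m+1,n)>1,\\ 1,& \text{exactly one of }\gcd(m,n),\gcd(m+1,n)\text{ equals }1,\\ 2,& \gcd(m,n)=\gcd(m+1,n)=1;\end{cases} \] \[ \text{(b)}\quad \sum_{d\mid n}\mu(d)\binom{\lfloor (m+1)/d\rfloor-\lfloor (m-1)/d\rfloor+1}{2}=\begin{cases}1,& \gcd(m,n)>1\text{ and }\gcd(m+1,n)>1,\\ 2,& \text{exactly one of }\gcd(m,n),\gcd(m+1,n)\text{ equals }1,\\ 3,& \gcd(m,n)=\gcd(m+1,n)=1.\end{cases} \]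
   Context: $\mu$ is the Möbius function and $\lfloor x\rfloor$ the floor function. -}

module Defs where

open import Data.Nat using (ℕ; zero; suc; _+_; _*_; _∸_; _/_; _^_)
open import Data.Nat.Divisibility using (_∣_; _∣?_)
open import Data.Nat.Primality using (Prime; prime?)
open import Data.Nat.Combinatorics using (_C_)
open import Data.Integer using (ℤ; +_; -_)
import Data.Integer as ℤ
open import Data.List using (List; []; _∷_; filter; map; length; sum)
open import Data.List.Base using (applyUpTo; foldr)
open import Data.Product using (_×_)
open import Relation.Nullary.Decidable using (_×-dec_; ¬?)

oneTo : ℕ → List ℕ
oneTo n = applyUpTo suc n

primesUpTo : ℕ → List ℕ
primesUpTo n = filter prime? (oneTo n)

primeDivisors : ℕ → List ℕ
primeDivisors n = filter (λ p → p ∣? n) (primesUpTo n)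

squarePrimeDivisors : ℕ → List ℕ
squarePrimeDivisors n = filter (λ p → (p * p) ∣? n) (primesUpTo n)

negOnePow : ℕ → ℤ
negOnePow zero = + 1
negOnePow (suc k) = - negOnePow k

μ : ℕ → ℤ
μ d with squarePrimeDivisors d
... | [] = negOnePow (length (primeDivisors d))
... | _ ∷ _ = + 0

divisors : ℕ → List ℕ
divisors n = filter (λ d → d ∣? n) (oneTo n)

sumDivisors : ℕ → (ℕ → ℤ) → ℤ
sumDivisors n f = foldr (λ d acc → f d ℤ.+ acc) (+ 0) (divisors n)

-- ⌊(m+1)/d⌋ - ⌊(m-1)/d⌋ for d ≥ 1 (zero-case irrelevant; m ≥ 1 so m - 1 = m ∸ 1)
floorDiff : ℕ → ℕ → ℕ
floorDiff m zero = 0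
floorDiff m (suc k) = (suc m / suc k) ∸ ((m ∸ 1) / suc k)

module Submission where

-- For d ≥ 1 and m ≥ 1 the floor difference ⌊(m+1)/d⌋ − ⌊(m−1)/d⌋ equals
-- [d ∣ m] + [d ∣ m+1], because ⌊(x+1)/d⌋ = ⌊x/d⌋ + [d ∣ x+1].  Sum (a) thus
-- splits into Σ_{d∣n} μ(d)[d∣m] + Σ_{d∣n} μ(d)[d∣m+1], and each piece is a
-- divisor sum over gcd(·,n), so equals [gcd(m,n)=1] resp. [gcd(m+1,n)=1] by the
-- Möbius identity Σ_{d∣g} μ(d) = [g=1].  For (b): no d ≥ 2 divides both m and
-- m+1, so writing f for the floor difference, C(f+1,2) = f + [d ∣ 1], and the
-- extra term contributes Σ_{d∣n} μ(d)[d∣1] = [gcd(1,n)=1] = 1.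

open import Defs
open import Data.Nat using (ℕ; zero; suc; _+_; _*_; _∸_; _<_; _≤_; z≤n; s≤s; NonZero; _/_; _%_)
import Data.Nat.Properties as ℕP
open import Data.Nat.Base using (>-nonZero; nonTrivial⇒n>1)
open import Data.Nat.DivMod using (m≡m%n+[m/n]*n; m%n<n; +-distrib-/-∣ʳ; m<n⇒m/n≡0; m*n/n≡m)
open import Data.Nat.Divisibility
open import Data.Nat.GCD using (gcd; gcd[m,n]∣m; gcd[m,n]∣n; gcd-greatest; gcd[m,n]≢0; gcd-zeroˡ)
open import Data.Nat.Combinatorics using (_C_)
open import Data.Nat.Primality using (Prime; prime?; euclidsLemma; prime⇒irreducible; prime⇒nonZero; prime⇒nonTrivial)
open import Data.Nat.Primality.Factorisation using (factorise)
open import Data.Nat.Coprimality using (Coprime; coprime-divisor)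
open import Data.Nat.ListAction using (product)
open import Data.Integer using (ℤ; +_; -_)
import Data.Integer as ℤ
open import Data.Integer using () renaming (_+_ to _+ℤ_; _*_ to _*ℤ_)
import Data.Integer.Properties as ℤP
open import Algebra.Properties.CommutativeSemigroup ℤP.+-commutativeSemigroup using (interchange)
open import Data.List using (List; []; _∷_; filter; length; _++_; [_])
open import Data.List.Base using (foldr)
import Data.List.Properties as LP
open import Data.List.Relation.Unary.All using (_∷_)
open import Data.List.Membership.Propositional using (_∈_)
open import Data.List.Relation.Unary.Any using (here)
open import Data.List.Membership.Propositional.Properties using (∈-filter⁺; ∈-filter⁻; ∈-applyUpTo⁺)
open import Data.Sum using (inj₁; inj₂)
open import Data.Product using (_×_; _,_; proj₂; ∃-syntax)
open import Data.Empty using (⊥-elim)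
open import Relation.Nullary using (Dec; yes; no; ¬_)
open import Relation.Nullary.Decidable using (_×-dec_; ¬?)
open import Relation.Unary using (Decidable)
open import Relation.Binary.PropositionalEquality hiding ([_])

private variable
  A B : Set
  x y : ℤ

sumTo : ℕ → (ℕ → ℤ) → ℤ
sumTo zero    f = + 0
sumTo (suc N) f = sumTo N f +ℤ f (suc N)

sumTo-cong : ∀ N {f g : ℕ → ℤ} → (∀ d → 1 ≤ d → d ≤ N → f d ≡ g d) → sumTo N f ≡ sumTo N g
sumTo-cong zero    eq = refl
sumTo-cong (suc N) eq =
  cong₂ _+ℤ_ (sumTo-cong N (λ d 1≤d d≤N → eq d 1≤d (ℕP.m≤n⇒m≤1+n d≤N))) (eq (suc N) (s≤s z≤n) ℕP.≤-refl)

sumTo-zero : ∀ N (f : ℕ → ℤ) → (∀ d → 1 ≤ d → d ≤ N → f d ≡ + 0) → sumTo N f ≡ + 0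
sumTo-zero N f eq = trans (sumTo-cong N eq) (sumTo-const0 N)
  where
  sumTo-const0 : ∀ N → sumTo N (λ _ → + 0) ≡ + 0
  sumTo-const0 zero    = refl
  sumTo-const0 (suc N) = cong (_+ℤ + 0) (sumTo-const0 N)

sumTo-+ : ∀ N (f g : ℕ → ℤ) → sumTo N (λ d → f d +ℤ g d) ≡ sumTo N f +ℤ sumTo N g
sumTo-+ zero    f g = refl
sumTo-+ (suc N) f g =
  trans (cong (_+ℤ (f (suc N) +ℤ g (suc N))) (sumTo-+ N f g))
        (interchange (sumTo N f) (sumTo N g) (f (suc N)) (g (suc N)))

sumTo-neg : ∀ N (f : ℕ → ℤ) → sumTo N (λ d → - f d) ≡ - sumTo N f
sumTo-neg zero    f = refl
sumTo-neg (suc N) f =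
  trans (cong (_+ℤ (- f (suc N))) (sumTo-neg N f)) (sym (ℤP.neg-distrib-+ (sumTo N f) (f (suc N))))

sumTo-truncate : ∀ {N N'} (f : ℕ → ℤ) → N ≤ N' → (∀ d → N < d → d ≤ N' → f d ≡ + 0) →
                 sumTo N' f ≡ sumTo N f
sumTo-truncate {N} {zero}   f z≤n vanish = refl
sumTo-truncate {N} {suc N'} f N≤N' vanish with ℕP.m≤n⇒m<n∨m≡n N≤N'
... | inj₂ refl       = refl
... | inj₁ (s≤s N≤N'') =
  trans (cong₂ _+ℤ_ (sumTo-truncate f N≤N'' (λ d N<d d≤N' → vanish d N<d (ℕP.m≤n⇒m≤1+n d≤N')))
                    (vanish (suc N') (s≤s N≤N'') ℕP.≤-refl))
        (ℤP.+-identityʳ _)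

sumTo-split : ∀ a b (f : ℕ → ℤ) → sumTo (a + b) f ≡ sumTo a f +ℤ sumTo b (λ i → f (a + i))
sumTo-split a zero    f rewrite ℕP.+-identityʳ a = sym (ℤP.+-identityʳ _)
sumTo-split a (suc b) f rewrite ℕP.+-suc a b =
  trans (cong (_+ℤ f (suc (a + b))) (sumTo-split a b f)) (ℤP.+-assoc (sumTo a f) _ _)

when : Dec A → ℤ → ℤ
when (yes _) x = x
when (no _)  x = + 0

iverson : Dec A → ℕ
iverson (yes _) = 1
iverson (no _)  = 0

when-holds : A → (D : Dec A) → when D x ≡ x
when-holds a (yes _) = refl
when-holds a (no ¬a) = ⊥-elim (¬a a)

when-fails : ¬ A → (D : Dec A) → when D x ≡ + 0
when-fails ¬a (yes a) = ⊥-elim (¬a a)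
when-fails ¬a (no _)  = refl

when-⇔ : (A → B) → (B → A) → (D : Dec A) (E : Dec B) → when D x ≡ when E x
when-⇔ to from (yes a) E = sym (when-holds (to a) E)
when-⇔ to from (no ¬a) E = sym (when-fails (λ b → ¬a (from b)) E)

when-× : (D : Dec A) (E : Dec B) → when D (when E x) ≡ when (D ×-dec E) x
when-× (yes _) (yes _) = refl
when-× (yes _) (no _)  = refl
when-× (no _)  _       = refl

when-comm : (D : Dec A) (E : Dec B) → when D (when E x) ≡ when E (when D x)
when-comm (yes _) (yes _) = refl
when-comm (yes _) (no _)  = refl
when-comm (no _)  (yes _) = refl
when-comm (no _)  (no _)  = refl

when-+ : (D : Dec A) → when D (x +ℤ y) ≡ when D x +ℤ when D y
when-+ (yes _) = refl
when-+ (no _)  = refl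

when-neg : (D : Dec A) → when D (- x) ≡ - when D x
when-neg (yes _) = refl
when-neg (no _)  = refl

when-split : (D : Dec A) → when D x +ℤ when (¬? D) x ≡ x
when-split {x = x} (yes _) = ℤP.+-identityʳ x
when-split {x = x} (no _)  = ℤP.+-identityˡ x

*-iverson : (D : Dec A) → x *ℤ + iverson D ≡ when D x
*-iverson {x = x} (yes _) = ℤP.*-identityʳ x
*-iverson {x = x} (no _)  = ℤP.*-zeroʳ x

*-+iverson : ∀ a (E : Dec B) → x *ℤ + (a + iverson E) ≡ x *ℤ + a +ℤ when E x
*-+iverson {x = x} a E = begin
  x *ℤ + (a + iverson E)               ≡⟨ cong (x *ℤ_) (ℤP.pos-+ a (iverson E)) ⟩
  x *ℤ (+ a +ℤ + iverson E)            ≡⟨ ℤP.*-distribˡ-+ x (+ a) (+ iverson E) ⟩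
  x *ℤ + a +ℤ x *ℤ + iverson E         ≡⟨ cong (x *ℤ + a +ℤ_) (*-iverson E) ⟩
  x *ℤ + a +ℤ when E x                 ∎
  where open ≡-Reasoning

isOne : ℕ → ℤ
isOne g = when (g ℕP.≟ 1) (+ 1)

divisorSum : ℕ → (ℕ → ℤ) → ℤ
divisorSum n f = sumTo n (λ d → when (d ∣? n) (f d))

divisorSum-+ : ∀ n (f g : ℕ → ℤ) → divisorSum n (λ d → f d +ℤ g d) ≡ divisorSum n f +ℤ divisorSum n g
divisorSum-+ n f g =
  trans (sumTo-cong n (λ d _ _ → when-+ (d ∣? n))) (sumTo-+ n _ _)

divisorSum-extend : ∀ {g N} (f : ℕ → ℤ) → 1 ≤ g → g ≤ N →
                    sumTo N (λ d → when (d ∣? g) (f d)) ≡ divisorSum g f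
divisorSum-extend {g} f 1≤g g≤N = sumTo-truncate _ g≤N beyond
  where
  beyond : ∀ d → g < d → d ≤ _ → when (d ∣? g) (f d) ≡ + 0
  beyond d g<d _ = when-fails (λ d∣g → ℕP.<⇒≱ g<d (∣⇒≤ {{>-nonZero 1≤g}} d∣g)) (d ∣? g)

listSum : List ℕ → (ℕ → ℤ) → ℤ
listSum L f = foldr (λ d acc → f d +ℤ acc) (+ 0) L

listSum-filter : ∀ {P : ℕ → Set} (P? : Decidable P) L f →
                 listSum (filter P? L) f ≡ listSum L (λ d → when (P? d) (f d))
listSum-filter P? []      f = refl
listSum-filter P? (x ∷ L) f with P? x
... | yes _ = cong (f x +ℤ_) (listSum-filter P? L f)
... | no _  = trans (listSum-filter P? L f) (sym (ℤP.+-identityˡ _))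

listSum-oneTo : ∀ N f → listSum (oneTo N) f ≡ sumTo N f
listSum-oneTo zero    f = refl
listSum-oneTo (suc N) f = begin
  listSum (oneTo (suc N)) f                      ≡⟨ cong (λ L → listSum L f) (sym (LP.applyUpTo-∷ʳ suc N)) ⟩
  listSum (oneTo N ++ [ suc N ]) f               ≡⟨ LP.foldr-++ step (+ 0) (oneTo N) [ suc N ] ⟩
  foldr step (f (suc N) +ℤ + 0) (oneTo N)        ≡⟨ fold-init (f (suc N) +ℤ + 0) (oneTo N) ⟩
  listSum (oneTo N) f +ℤ (f (suc N) +ℤ + 0)      ≡⟨ cong₂ _+ℤ_ (listSum-oneTo N f) (ℤP.+-identityʳ _) ⟩
  sumTo N f +ℤ f (suc N)                         ∎
  where
  open ≡-Reasoning
  step : ℕ → ℤ → ℤ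
  step d acc = f d +ℤ acc
  fold-init : ∀ c L → foldr step c L ≡ listSum L f +ℤ c
  fold-init c []      = sym (ℤP.+-identityˡ c)
  fold-init c (x ∷ L) = trans (cong (f x +ℤ_) (fold-init c L)) (sym (ℤP.+-assoc (f x) _ c))

length-listSum : ∀ (L : List ℕ) → + length L ≡ listSum L (λ _ → + 1)
length-listSum []      = refl
length-listSum (x ∷ L) = cong (+ 1 +ℤ_) (length-listSum L)

sumDivisors≡divisorSum : ∀ n f → sumDivisors n f ≡ divisorSum n f
sumDivisors≡divisorSum n f =
  trans (listSum-filter (λ d → d ∣? n) (oneTo n) f) (listSum-oneTo n _)

prime>1 : ∀ {p} → Prime p → 1 < p
prime>1 {p} pp = nonTrivial⇒n>1 p {{prime⇒nonTrivial pp}}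

prime∤⇒coprime : ∀ {p x} → Prime p → ¬ p ∣ x → Coprime x p
prime∤⇒coprime pp p∤x {c} (c∣x , c∣p) with prime⇒irreducible pp c∣p
... | inj₁ c≡1 = c≡1
... | inj₂ refl = ⊥-elim (p∤x c∣x)

prime∣prime⇒≡ : ∀ {p q} → Prime q → Prime p → q ∣ p → q ≡ p
prime∣prime⇒≡ pq pp q∣p with prime⇒irreducible pp q∣p
... | inj₁ refl = ⊥-elim (ℕP.<-irrefl refl (prime>1 pq))
... | inj₂ q≡p  = q≡p

primeDivisor : ∀ g → 1 < g → ∃[ p ] (Prime p × p ∣ g)
primeDivisor g 1<g with factorise g {{>-nonZero (ℕP.<⇒≤ 1<g)}}
... | record { factors = [] ; isFactorisation = eq } = ⊥-elim (ℕP.<-irrefl (sym eq) 1<g)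
... | record { factors = p ∷ ps ; isFactorisation = eq ; factorsPrime = pp ∷ _ } =
  p , pp , subst (p ∣_) (sym eq) (m∣m*n (product ps))

square∣*prime⇒square∣ : ∀ {p q e} → Prime p → Prime q → ¬ p ∣ e → q * q ∣ e * p → q * q ∣ e
square∣*prime⇒square∣ {p} {q} {e} pp pq p∤e q²∣ep with p ∣? (q * q)
... | no p∤q² = coprime-divisor (prime∤⇒coprime pp p∤q²) (subst (q * q ∣_) (ℕP.*-comm e p) q²∣ep)
... | yes p∣q² = ⊥-elim (p∤e (*-cancelʳ-∣ p {{prime⇒nonZero pp}} p²∣ep))
  where
  q≡p : q ≡ p
  q≡p with euclidsLemma q q pp p∣q²
  ... | inj₁ p∣q = sym (prime∣prime⇒≡ pp pq p∣q)
  ... | inj₂ p∣q = sym (prime∣prime⇒≡ pp pq p∣q)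
  p²∣ep : p * p ∣ e * p
  p²∣ep = subst (λ r → r * r ∣ e * p) q≡p q²∣ep

isPrime : ℕ → ℤ
isPrime q = when (prime? q) (+ 1)

primeDivisors-count : ∀ n → + length (primeDivisors n) ≡ divisorSum n isPrime
primeDivisors-count n = begin
  + length (primeDivisors n)                                     ≡⟨ length-listSum (primeDivisors n) ⟩
  listSum (primeDivisors n) (λ _ → + 1)                          ≡⟨ listSum-filter (λ q → q ∣? n) (primesUpTo n) _ ⟩
  listSum (primesUpTo n) (λ q → when (q ∣? n) (+ 1))             ≡⟨ listSum-filter prime? (oneTo n) _ ⟩
  listSum (oneTo n) (λ q → when (prime? q) (when (q ∣? n) (+ 1))) ≡⟨ listSum-oneTo n _ ⟩
  sumTo n (λ q → when (prime? q) (when (q ∣? n) (+ 1)))          ≡⟨ sumTo-cong n (λ q _ _ → when-comm (prime? q) (q ∣? n)) ⟩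
  divisorSum n isPrime                                           ∎
  where open ≡-Reasoning

isPrime-divides-*p : ∀ {p e} q → Prime p → ¬ p ∣ e →
  when (q ∣? e * p) (isPrime q) ≡ when (q ∣? e) (isPrime q) +ℤ when (q ℕP.≟ p) (+ 1)
isPrime-divides-*p {p} {e} q pp p∤e with q ℕP.≟ p
... | yes refl = begin
  when (q ∣? e * q) (isPrime q) ≡⟨ when-holds (n∣m*n e) (q ∣? e * q) ⟩
  isPrime q                     ≡⟨ when-holds pp (prime? q) ⟩
  + 1                           ≡⟨ cong (_+ℤ + 1) (sym (when-fails p∤e (q ∣? e))) ⟩
  when (q ∣? e) (isPrime q) +ℤ + 1 ∎
  where open ≡-Reasoning
... | no q≢p = begin
  when (q ∣? e * p) (isPrime q)         ≡⟨ when-× (q ∣? e * p) (prime? q) ⟩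
  when (q ∣? e * p ×-dec prime? q) (+ 1) ≡⟨ when-⇔ to from (q ∣? e * p ×-dec prime? q) (q ∣? e ×-dec prime? q) ⟩
  when (q ∣? e ×-dec prime? q) (+ 1)     ≡⟨ sym (when-× (q ∣? e) (prime? q)) ⟩
  when (q ∣? e) (isPrime q)             ≡⟨ sym (ℤP.+-identityʳ _) ⟩
  when (q ∣? e) (isPrime q) +ℤ + 0      ∎
  where
  open ≡-Reasoning
  to : q ∣ e * p × Prime q → q ∣ e × Prime q
  to (q∣ep , pq) with euclidsLemma e p pq q∣ep
  ... | inj₁ q∣e = q∣e , pq
  ... | inj₂ q∣p = ⊥-elim (q≢p (prime∣prime⇒≡ pq pp q∣p))
  from : q ∣ e × Prime q → q ∣ e * p × Prime q
  from (q∣e , pq) = ∣-trans q∣e (m∣m*n p) , pq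

sumTo-delta : ∀ {p N} → 1 ≤ p → p ≤ N → sumTo N (λ q → when (q ℕP.≟ p) (+ 1)) ≡ + 1
sumTo-delta {suc p'} {N} _ p≤N = begin
  sumTo N δ                 ≡⟨ sumTo-truncate δ p≤N (λ q p<q _ → when-fails (λ q≡p → ℕP.<-irrefl (sym q≡p) p<q) (q ℕP.≟ suc p')) ⟩
  sumTo p' δ +ℤ δ (suc p')  ≡⟨ cong₂ _+ℤ_ (sumTo-zero p' δ below) (when-holds refl (suc p' ℕP.≟ suc p')) ⟩
  + 1                       ∎
  where
  open ≡-Reasoning
  δ : ℕ → ℤ
  δ q = when (q ℕP.≟ suc p') (+ 1)
  below : ∀ q → 1 ≤ q → q ≤ p' → δ q ≡ + 0
  below q _ q≤p' = when-fails (λ { refl → ℕP.<-irrefl refl q≤p' }) (q ℕP.≟ suc p')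

primeDivisorCount-*p : ∀ {p e} → Prime p → ¬ p ∣ e → 1 ≤ e →
  length (primeDivisors (e * p)) ≡ suc (length (primeDivisors e))
primeDivisorCount-*p {p} {e} pp p∤e 1≤e = ℤP.+-injective (begin
  + length (primeDivisors (e * p))              ≡⟨ primeDivisors-count (e * p) ⟩
  divisorSum (e * p) isPrime                    ≡⟨ sumTo-cong (e * p) (λ q _ _ → isPrime-divides-*p q pp p∤e) ⟩
  sumTo (e * p) (λ q → when (q ∣? e) (isPrime q) +ℤ δ q) ≡⟨ sumTo-+ (e * p) _ δ ⟩
  sumTo (e * p) (λ q → when (q ∣? e) (isPrime q)) +ℤ sumTo (e * p) δ
    ≡⟨ cong₂ _+ℤ_ (divisorSum-extend isPrime 1≤e e≤ep) (sumTo-delta 1≤p p≤ep) ⟩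
  divisorSum e isPrime +ℤ + 1                   ≡⟨ cong (_+ℤ + 1) (sym (primeDivisors-count e)) ⟩
  + length (primeDivisors e) +ℤ + 1             ≡⟨ sym (ℤP.pos-+ (length (primeDivisors e)) 1) ⟩
  + (length (primeDivisors e) + 1)              ≡⟨ cong +_ (ℕP.+-comm _ 1) ⟩
  + suc (length (primeDivisors e))              ∎)
  where
  open ≡-Reasoning
  δ : ℕ → ℤ
  δ q = when (q ℕP.≟ p) (+ 1)
  1≤p : 1 ≤ p
  1≤p = ℕP.<⇒≤ (prime>1 pp)
  e≤ep : e ≤ e * p
  e≤ep = ℕP.m≤m*n e p {{>-nonZero 1≤p}}
  p≤ep : p ≤ e * p
  p≤ep = ℕP.m≤n*m p e {{>-nonZero 1≤e}}

squarePrimeDivisors-complete : ∀ {n q} → .{{NonZero n}} → Prime q → q * q ∣ n → q ∈ squarePrimeDivisors n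
squarePrimeDivisors-complete {n} {suc i} pq q²∣n =
  ∈-filter⁺ (λ p → (p * p) ∣? n) {xs = primesUpTo n}
    (∈-filter⁺ prime? {xs = oneTo n} (∈-applyUpTo⁺ suc (∣⇒≤ (m*n∣⇒m∣ (suc i) (suc i) q²∣n))) pq) q²∣n

squarePrimeDivisors-sound : ∀ {n q} → q ∈ squarePrimeDivisors n → Prime q × q * q ∣ n
squarePrimeDivisors-sound {n} q∈ with ∈-filter⁻ (λ p → (p * p) ∣? n) {xs = primesUpTo n} q∈
... | q∈primes , q²∣n = proj₂ (∈-filter⁻ prime? {xs = oneTo n} q∈primes) , q²∣n

μ-squareful : ∀ n q → .{{NonZero n}} → Prime q → q * q ∣ n → μ n ≡ + 0
μ-squareful n q pq q²∣n with squarePrimeDivisors n | squarePrimeDivisors-complete {n} pq q²∣n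
... | []    | ()
... | _ ∷ _ | _ = refl

-- μ(e·p) = −μ(e) for a prime p ∤ e: square-freeness is preserved in both
-- directions and one more prime divisor flips the sign.
μ-*prime-coprime : ∀ {p e} → Prime p → ¬ p ∣ e → 1 ≤ e → μ (e * p) ≡ - μ e
μ-*prime-coprime {p} {e} pp p∤e 1≤e
  with squarePrimeDivisors (e * p) in eqEP | squarePrimeDivisors e in eqE
... | []    | []    = cong negOnePow (primeDivisorCount-*p pp p∤e 1≤e)
... | _ ∷ _ | _ ∷ _ = refl
... | []    | q ∷ _ with squarePrimeDivisors-sound {e} {q} (subst (q ∈_) (sym eqE) (here refl))
...   | pq , q²∣e with subst (q ∈_) eqEP (squarePrimeDivisors-complete {e * p}
                         {{>-nonZero (ℕP.≤-trans 1≤e (ℕP.m≤m*n e p {{prime⇒nonZero pp}}))}} pq (∣-trans q²∣e (m∣m*n p)))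
...     | ()
μ-*prime-coprime {p} {e} pp p∤e 1≤e | q ∷ _ | []
  with squarePrimeDivisors-sound {e * p} {q} (subst (q ∈_) (sym eqEP) (here refl))
...   | pq , q²∣ep with subst (q ∈_) eqE (squarePrimeDivisors-complete {e} {{>-nonZero 1≤e}} pq
                         (square∣*prime⇒square∣ pp pq p∤e q²∣ep))
...     | ()

μ-*prime : ∀ {p e} → Prime p → 1 ≤ e → μ (e * p) ≡ - when (¬? (p ∣? e)) (μ e)
μ-*prime {p} {e} pp 1≤e with p ∣? e
... | yes p∣e = μ-squareful (e * p) p {{>-nonZero (ℕP.≤-trans 1≤e (ℕP.m≤m*n e p {{prime⇒nonZero pp}}))}}
                  pp (*-monoˡ-∣ p p∣e)
... | no p∤e  = μ-*prime-coprime pp p∤e 1≤e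

sumTo-multiples : ∀ p K (f : ℕ → ℤ) → 1 ≤ p → sumTo (K * p) (λ d → when (p ∣? d) (f d)) ≡ sumTo K (λ e → f (e * p))
sumTo-multiples p zero    f _   = refl
sumTo-multiples p (suc K) f 1≤p = begin
  sumTo (p + K * p) F                               ≡⟨ cong (λ N → sumTo N F) (ℕP.+-comm p (K * p)) ⟩
  sumTo (K * p + p) F                               ≡⟨ sumTo-split (K * p) p F ⟩
  sumTo (K * p) F +ℤ sumTo p (λ i → F (K * p + i))  ≡⟨ cong₂ _+ℤ_ (sumTo-multiples p K f 1≤p) (lastBlock (K * p) p (n∣m*n K) 1≤p) ⟩
  sumTo K (λ e → f (e * p)) +ℤ f (K * p + p)        ≡⟨ cong (λ x → sumTo K (λ e → f (e * p)) +ℤ f x) (ℕP.+-comm (K * p) p) ⟩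
  sumTo K (λ e → f (e * p)) +ℤ f (p + K * p)        ∎
  where
  open ≡-Reasoning
  F : ℕ → ℤ
  F d = when (p ∣? d) (f d)
  -- among c+1, …, c+q with q ∣ c, only c+q is a multiple of q
  lastBlock : ∀ c q → q ∣ c → 1 ≤ q → sumTo q (λ i → when (q ∣? (c + i)) (f (c + i))) ≡ f (c + q)
  lastBlock c (suc q') q∣c _ =
    trans (cong₂ _+ℤ_ (sumTo-zero q' _ inner) (when-holds (∣m∣n⇒∣m+n q∣c ∣-refl) (suc q' ∣? (c + suc q'))))
          (ℤP.+-identityˡ _)
    where
    inner : ∀ i → 1 ≤ i → i ≤ q' → when (suc q' ∣? (c + i)) (f (c + i)) ≡ + 0
    inner i 1≤i i≤q' = when-fails (λ q∣c+i → ℕP.<⇒≱ (s≤s i≤q') (∣⇒≤ {{>-nonZero 1≤i}} (∣m+n∣m⇒∣n q∣c+i q∣c))) (suc q' ∣? (c + i))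

-- Σ_{d ∣ h·p} μ(d) = 0 for a prime p and h ≥ 1.  The divisors d with p ∣ d are
-- d = e·p with e ∣ h, contributing −[p∤e]μ(e); those with p ∤ d are the
-- divisors of h not divisible by p, contributing [p∤d]μ(d).  The two cancel.
mobius-*prime : ∀ h p → Prime p → 1 ≤ h → divisorSum (h * p) μ ≡ + 0
mobius-*prime h p pp 1≤h = begin
  sumTo (h * p) T
    ≡⟨ sumTo-cong (h * p) (λ d _ _ → sym (when-split (p ∣? d))) ⟩
  sumTo (h * p) (λ d → when (p ∣? d) (T d) +ℤ when (¬? (p ∣? d)) (T d))
    ≡⟨ sumTo-+ (h * p) _ _ ⟩
  sumTo (h * p) (λ d → when (p ∣? d) (T d)) +ℤ sumTo (h * p) (λ d → when (¬? (p ∣? d)) (T d))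
    ≡⟨ cong₂ _+ℤ_ (sumTo-multiples p h T 1≤p) (sumTo-cong (h * p) (λ d _ _ → coprimeTerm d)) ⟩
  sumTo h (λ e → T (e * p)) +ℤ sumTo (h * p) (λ d → when (d ∣? h) (G d))
    ≡⟨ cong₂ _+ℤ_ (sumTo-cong h (λ e 1≤e _ → multipleTerm e 1≤e)) (divisorSum-extend G 1≤h h≤hp) ⟩
  sumTo h (λ e → - when (e ∣? h) (G e)) +ℤ divisorSum h G
    ≡⟨ cong (_+ℤ divisorSum h G) (sumTo-neg h _) ⟩
  - divisorSum h G +ℤ divisorSum h G
    ≡⟨ ℤP.+-inverseˡ (divisorSum h G) ⟩
  + 0 ∎
  where
  open ≡-Reasoning
  1≤p : 1 ≤ p
  1≤p = ℕP.<⇒≤ (prime>1 pp)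
  h≤hp : h ≤ h * p
  h≤hp = ℕP.m≤m*n h p {{>-nonZero 1≤p}}
  T : ℕ → ℤ
  T d = when (d ∣? (h * p)) (μ d)
  G : ℕ → ℤ
  G e = when (¬? (p ∣? e)) (μ e)
  multipleTerm : ∀ e → 1 ≤ e → T (e * p) ≡ - when (e ∣? h) (G e)
  multipleTerm e 1≤e = begin
    when (e * p ∣? h * p) (μ (e * p)) ≡⟨ cong (when (e * p ∣? h * p)) (μ-*prime pp 1≤e) ⟩
    when (e * p ∣? h * p) (- G e)     ≡⟨ when-neg (e * p ∣? h * p) ⟩
    - when (e * p ∣? h * p) (G e)     ≡⟨ cong -_ (when-⇔ (*-cancelʳ-∣ p {{>-nonZero 1≤p}}) (*-monoˡ-∣ p) (e * p ∣? h * p) (e ∣? h)) ⟩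
    - when (e ∣? h) (G e)             ∎
  coprimeTerm : ∀ d → when (¬? (p ∣? d)) (T d) ≡ when (d ∣? h) (G d)
  coprimeTerm d = begin
    when (¬? (p ∣? d)) (T d)                 ≡⟨ when-comm (¬? (p ∣? d)) (d ∣? h * p) ⟩
    when (d ∣? h * p) (G d)                  ≡⟨ when-× (d ∣? h * p) (¬? (p ∣? d)) ⟩
    when (d ∣? h * p ×-dec ¬? (p ∣? d)) (μ d) ≡⟨ when-⇔ to from (d ∣? h * p ×-dec ¬? (p ∣? d)) (d ∣? h ×-dec ¬? (p ∣? d)) ⟩
    when (d ∣? h ×-dec ¬? (p ∣? d)) (μ d)    ≡⟨ sym (when-× (d ∣? h) (¬? (p ∣? d))) ⟩
    when (d ∣? h) (G d)                      ∎
    where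
    to : d ∣ h * p × ¬ p ∣ d → d ∣ h × ¬ p ∣ d
    to (d∣hp , p∤d) = coprime-divisor (prime∤⇒coprime pp p∤d) (subst (d ∣_) (ℕP.*-comm h p) d∣hp) , p∤d
    from : d ∣ h × ¬ p ∣ d → d ∣ h * p × ¬ p ∣ d
    from (d∣h , p∤d) = ∣-trans d∣h (m∣m*n p) , p∤d

mobius : ∀ g → 1 ≤ g → divisorSum g μ ≡ isOne g
mobius g 1≤g with g ℕP.≟ 1
... | yes refl = refl
... | no g≢1 with primeDivisor g (ℕP.≤∧≢⇒< 1≤g (λ 1≡g → g≢1 (sym 1≡g)))
...   | p , pp , divides h g≡hp =
  trans (cong (λ n → divisorSum n μ) g≡hp) (mobius-*prime h p pp 1≤h)
  where
  1≤h : 1 ≤ h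
  1≤h = ℕP.n≢0⇒n>0 (λ h≡0 → ℕP.<⇒≢ 1≤g (sym (trans g≡hp (cong (_* p) h≡0))))

-- Σ_{d ∣ n} [d ∣ m] μ(d) = Σ_{d ∣ gcd(m,n)} μ(d) = [gcd(m,n) = 1] for n ≥ 1.
mobius-gcd : ∀ m n → 1 ≤ n → divisorSum n (λ d → when (d ∣? m) (μ d)) ≡ isOne (gcd m n)
mobius-gcd m n 1≤n = begin
  sumTo n (λ d → when (d ∣? n) (when (d ∣? m) (μ d))) ≡⟨ sumTo-cong n (λ d _ _ → commonDivisor d) ⟩
  sumTo n (λ d → when (d ∣? gcd m n) (μ d))           ≡⟨ divisorSum-extend μ 1≤g g≤n ⟩
  divisorSum (gcd m n) μ                              ≡⟨ mobius (gcd m n) 1≤g ⟩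
  isOne (gcd m n)                                     ∎
  where
  open ≡-Reasoning
  1≤g : 1 ≤ gcd m n
  1≤g = ℕP.n≢0⇒n>0 (gcd[m,n]≢0 m n (inj₂ (ℕP.n>0⇒n≢0 1≤n)))
  g≤n : gcd m n ≤ n
  g≤n = ∣⇒≤ {{>-nonZero 1≤n}} (gcd[m,n]∣n m n)
  commonDivisor : ∀ d → when (d ∣? n) (when (d ∣? m) (μ d)) ≡ when (d ∣? gcd m n) (μ d)
  commonDivisor d = trans (when-× (d ∣? n) (d ∣? m))
    (when-⇔ (λ (d∣n , d∣m) → gcd-greatest d∣m d∣n)
            (λ d∣g → ∣-trans d∣g (gcd[m,n]∣n m n) , ∣-trans d∣g (gcd[m,n]∣m m n))
            (d ∣? n ×-dec d ∣? m) (d ∣? gcd m n))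

quotient-unique : ∀ k r q → r < suc k → (r + q * suc k) / suc k ≡ q
quotient-unique k r q r<d =
  trans (+-distrib-/-∣ʳ r (n∣m*n q)) (cong₂ _+_ (m<n⇒m/n≡0 r<d) (m*n/n≡m q (suc k)))

-- ⌊(x+1)/d⌋ = ⌊x/d⌋ + [d ∣ x+1] for d ≥ 1: write x = r + q·d with r < d; then
-- x + 1 reaches the next multiple of d exactly when r + 1 = d.
div-suc : ∀ x k → suc x / suc k ≡ x / suc k + iverson (suc k ∣? suc x)
div-suc x k = subst (λ y → suc y / suc k ≡ x / suc k + iverson (suc k ∣? suc y))
                    (sym (m≡m%n+[m/n]*n x (suc k)))
                    (euclid (x % suc k) (x / suc k) (m%n<n x (suc k)))
  where
  euclid : ∀ r q → r < suc k → suc (r + q * suc k) / suc k ≡ q + iverson (suc k ∣? suc (r + q * suc k))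
  euclid r q r<d with ℕP.m≤n⇒m<n∨m≡n r<d | suc k ∣? suc (r + q * suc k)
  ... | inj₁ r+1<d | no _ = trans (quotient-unique k (suc r) q r+1<d) (sym (ℕP.+-identityʳ q))
  ... | inj₁ r+1<d | yes d∣x+1 =
    ⊥-elim (ℕP.<⇒≱ r+1<d (∣⇒≤ (∣m+n∣m⇒∣n (subst (suc k ∣_) (ℕP.+-comm (suc r) (q * suc k)) d∣x+1) (n∣m*n q))))
  ... | inj₂ refl | no d∤x+1 = ⊥-elim (d∤x+1 (∣m∣n⇒∣m+n ∣-refl (n∣m*n q)))
  ... | inj₂ refl | yes _ = trans (m*n/n≡m (suc q) (suc r)) (ℕP.+-comm 1 q)

floorDiff-divisibility : ∀ m d → 1 ≤ m → 1 ≤ d → floorDiff m d ≡ iverson (d ∣? m) + iverson (d ∣? suc m)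
floorDiff-divisibility (suc m') (suc k) _ _ = begin
  suc (suc m') / suc k ∸ m' / suc k   ≡⟨ cong (_∸ m' / suc k) (div-suc (suc m') k) ⟩
  (suc m' / suc k + i₂) ∸ m' / suc k   ≡⟨ cong (λ z → (z + i₂) ∸ m' / suc k) (div-suc m' k) ⟩
  (m' / suc k + i₁ + i₂) ∸ m' / suc k  ≡⟨ cong (_∸ m' / suc k) (ℕP.+-assoc (m' / suc k) i₁ i₂) ⟩
  (m' / suc k + (i₁ + i₂)) ∸ m' / suc k ≡⟨ ℕP.m+n∸m≡n (m' / suc k) (i₁ + i₂) ⟩
  i₁ + i₂                              ∎
  where
  open ≡-Reasoning
  i₁ i₂ : ℕ
  i₁ = iverson (suc k ∣? suc m')
  i₂ = iverson (suc k ∣? suc (suc m'))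

consecutive-divisor : ∀ {d m} → d ∣ m → d ∣ suc m → d ≡ 1
consecutive-divisor {d} {m} d∣m d∣m+1 = ∣1⇒≡1 (∣m+n∣m⇒∣n (subst (d ∣_) (ℕP.+-comm 1 m) d∣m+1) d∣m)

-- With f = [d ∣ m] + [d ∣ m+1]: C(f+1, 2) = f + [d ∣ 1].  Indeed f ≤ 1 unless
-- d = 1, and C(1,2) = 0, C(2,2) = 1, C(3,2) = 3.
choose2-divisibility : ∀ d m → (iverson (d ∣? m) + iverson (d ∣? suc m) + 1) C 2
                                ≡ iverson (d ∣? m) + iverson (d ∣? suc m) + iverson (d ∣? 1)
choose2-divisibility d m with d ∣? 1 | d ∣? m | d ∣? suc m
... | yes _   | yes _   | yes _     = refl
... | yes d∣1 | no d∤m  | _         = ⊥-elim (d∤m (∣-trans d∣1 (1∣ m)))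
... | yes d∣1 | yes _   | no d∤m+1  = ⊥-elim (d∤m+1 (∣-trans d∣1 (1∣ suc m)))
... | no d∤1  | yes d∣m | yes d∣m+1 = ⊥-elim (d∤1 (subst (_∣ 1) (sym (consecutive-divisor d∣m d∣m+1)) ∣-refl))
... | no _    | yes _   | no _      = refl
... | no _    | no _    | yes _     = refl
... | no _    | no _    | no _      = refl

floorDiff-sum : ∀ m n → 1 ≤ m → 1 ≤ n →
  sumDivisors n (λ d → μ d *ℤ + floorDiff m d) ≡ isOne (gcd m n) +ℤ isOne (gcd (suc m) n)
floorDiff-sum m n 1≤m 1≤n = begin
  sumDivisors n (λ d → μ d *ℤ + floorDiff m d)
    ≡⟨ sumDivisors≡divisorSum n _ ⟩
  divisorSum n (λ d → μ d *ℤ + floorDiff m d)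
    ≡⟨ sumTo-cong n (λ d 1≤d _ → cong (when (d ∣? n)) (term d 1≤d)) ⟩
  divisorSum n (λ d → when (d ∣? m) (μ d) +ℤ when (d ∣? suc m) (μ d))
    ≡⟨ divisorSum-+ n _ _ ⟩
  divisorSum n (λ d → when (d ∣? m) (μ d)) +ℤ divisorSum n (λ d → when (d ∣? suc m) (μ d))
    ≡⟨ cong₂ _+ℤ_ (mobius-gcd m n 1≤n) (mobius-gcd (suc m) n 1≤n) ⟩
  isOne (gcd m n) +ℤ isOne (gcd (suc m) n) ∎
  where
  open ≡-Reasoning
  term : ∀ d → 1 ≤ d → μ d *ℤ + floorDiff m d ≡ when (d ∣? m) (μ d) +ℤ when (d ∣? suc m) (μ d)
  term d 1≤d = begin
    μ d *ℤ + floorDiff m d                               ≡⟨ cong (λ k → μ d *ℤ + k) (floorDiff-divisibility m d 1≤m 1≤d) ⟩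
    μ d *ℤ + (iverson (d ∣? m) + iverson (d ∣? suc m))    ≡⟨ *-+iverson {x = μ d} (iverson (d ∣? m)) (d ∣? suc m) ⟩
    μ d *ℤ + iverson (d ∣? m) +ℤ when (d ∣? suc m) (μ d)  ≡⟨ cong (_+ℤ when (d ∣? suc m) (μ d)) (*-iverson {x = μ d} (d ∣? m)) ⟩
    when (d ∣? m) (μ d) +ℤ when (d ∣? suc m) (μ d)        ∎

-- Formula (b) for all m, n ≥ 1: the binomial version exceeds (a) by
-- Σ_{d ∣ n} μ(d)[d ∣ 1] = [gcd(1,n) = 1] = 1.
choose2-sum : ∀ m n → 1 ≤ m → 1 ≤ n →
  sumDivisors n (λ d → μ d *ℤ + ((floorDiff m d + 1) C 2)) ≡ isOne (gcd m n) +ℤ isOne (gcd (suc m) n) +ℤ + 1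
choose2-sum m n 1≤m 1≤n = begin
  sumDivisors n (λ d → μ d *ℤ + ((floorDiff m d + 1) C 2))
    ≡⟨ sumDivisors≡divisorSum n _ ⟩
  divisorSum n (λ d → μ d *ℤ + ((floorDiff m d + 1) C 2))
    ≡⟨ sumTo-cong n (λ d 1≤d _ → cong (when (d ∣? n)) (term d 1≤d)) ⟩
  divisorSum n (λ d → μ d *ℤ + floorDiff m d +ℤ when (d ∣? 1) (μ d))
    ≡⟨ divisorSum-+ n _ _ ⟩
  divisorSum n (λ d → μ d *ℤ + floorDiff m d) +ℤ divisorSum n (λ d → when (d ∣? 1) (μ d))
    ≡⟨ cong₂ _+ℤ_ (trans (sym (sumDivisors≡divisorSum n _)) (floorDiff-sum m n 1≤m 1≤n)) (mobius-gcd 1 n 1≤n) ⟩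
  isOne (gcd m n) +ℤ isOne (gcd (suc m) n) +ℤ isOne (gcd 1 n)
    ≡⟨ cong (λ g → isOne (gcd m n) +ℤ isOne (gcd (suc m) n) +ℤ isOne g) (gcd-zeroˡ n) ⟩
  isOne (gcd m n) +ℤ isOne (gcd (suc m) n) +ℤ + 1 ∎
  where
  open ≡-Reasoning
  term : ∀ d → 1 ≤ d → μ d *ℤ + ((floorDiff m d + 1) C 2) ≡ μ d *ℤ + floorDiff m d +ℤ when (d ∣? 1) (μ d)
  term d 1≤d = begin
    μ d *ℤ + ((floorDiff m d + 1) C 2)
      ≡⟨ cong (λ k → μ d *ℤ + ((k + 1) C 2)) (floorDiff-divisibility m d 1≤m 1≤d) ⟩
    μ d *ℤ + ((iverson (d ∣? m) + iverson (d ∣? suc m) + 1) C 2)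
      ≡⟨ cong (λ k → μ d *ℤ + k) (choose2-divisibility d m) ⟩
    μ d *ℤ + (iverson (d ∣? m) + iverson (d ∣? suc m) + iverson (d ∣? 1))
      ≡⟨ *-+iverson {x = μ d} (iverson (d ∣? m) + iverson (d ∣? suc m)) (d ∣? 1) ⟩
    μ d *ℤ + (iverson (d ∣? m) + iverson (d ∣? suc m)) +ℤ when (d ∣? 1) (μ d)
      ≡⟨ cong (λ k → μ d *ℤ + k +ℤ when (d ∣? 1) (μ d)) (sym (floorDiff-divisibility m d 1≤m 1≤d)) ⟩
    μ d *ℤ + floorDiff m d +ℤ when (d ∣? 1) (μ d) ∎

theorem5 : (m n : ℕ) → 0 < m → 1 < n →
    ((1 < gcd m n → 1 < gcd (suc m) n →
        sumDivisors n (λ d → μ d ℤ.* + floorDiff m d) ≡ + 0)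
     × (gcd m n ≡ 1 → gcd (suc m) n ≢ 1 →
        sumDivisors n (λ d → μ d ℤ.* + floorDiff m d) ≡ + 1)
     × (gcd m n ≢ 1 → gcd (suc m) n ≡ 1 →
        sumDivisors n (λ d → μ d ℤ.* + floorDiff m d) ≡ + 1)
     × (gcd m n ≡ 1 → gcd (suc m) n ≡ 1 →
        sumDivisors n (λ d → μ d ℤ.* + floorDiff m d) ≡ + 2))
    ×
    ((1 < gcd m n → 1 < gcd (suc m) n →
        sumDivisors n (λ d → μ d ℤ.* + ((floorDiff m d + 1) C 2)) ≡ + 1)
     × (gcd m n ≡ 1 → gcd (suc m) n ≢ 1 →
        sumDivisors n (λ d → μ d ℤ.* + ((floorDiff m d + 1) C 2)) ≡ + 2)
     × (gcd m n ≢ 1 → gcd (suc m) n ≡ 1 →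
        sumDivisors n (λ d → μ d ℤ.* + ((floorDiff m d + 1) C 2)) ≡ + 2)
     × (gcd m n ≡ 1 → gcd (suc m) n ≡ 1 →
        sumDivisors n (λ d → μ d ℤ.* + ((floorDiff m d + 1) C 2)) ≡ + 3))
theorem5 m n 1≤m 1<n =
  ( (λ g₁ g₂ → sumA (>1 g₁) (>1 g₂)) , (λ g₁ g₂ → sumA (≡1 g₁) (≢1 g₂))
  , (λ g₁ g₂ → sumA (≢1 g₁) (≡1 g₂)) , (λ g₁ g₂ → sumA (≡1 g₁) (≡1 g₂)) )
  ,
  ( (λ g₁ g₂ → sumB (>1 g₁) (>1 g₂)) , (λ g₁ g₂ → sumB (≡1 g₁) (≢1 g₂))
  , (λ g₁ g₂ → sumB (≢1 g₁) (≡1 g₂)) , (λ g₁ g₂ → sumB (≡1 g₁) (≡1 g₂)) )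
  where
  1≤n = ℕP.<⇒≤ 1<n
  sumA : ∀ {a b} → isOne (gcd m n) ≡ a → isOne (gcd (suc m) n) ≡ b →
         sumDivisors n (λ d → μ d *ℤ + floorDiff m d) ≡ a +ℤ b
  sumA eq₁ eq₂ = trans (floorDiff-sum m n 1≤m 1≤n) (cong₂ _+ℤ_ eq₁ eq₂)
  sumB : ∀ {a b} → isOne (gcd m n) ≡ a → isOne (gcd (suc m) n) ≡ b →
         sumDivisors n (λ d → μ d *ℤ + ((floorDiff m d + 1) C 2)) ≡ a +ℤ b +ℤ + 1
  sumB eq₁ eq₂ = trans (choose2-sum m n 1≤m 1≤n) (cong (_+ℤ + 1) (cong₂ _+ℤ_ eq₁ eq₂))
  ≡1 : ∀ {g} → g ≡ 1 → isOne g ≡ + 1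
  ≡1 {g} g≡1 = when-holds g≡1 (g ℕP.≟ 1)
  ≢1 : ∀ {g} → g ≢ 1 → isOne g ≡ + 0
  ≢1 {g} g≢1 = when-fails g≢1 (g ℕP.≟ 1)
  >1 : ∀ {g} → 1 < g → isOne g ≡ + 0
  >1 1<g = ≢1 (λ g≡1 → ℕP.<-irrefl (sym g≡1) 1<g)
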